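{- Let $R_n(x)=\sum_{k=0}^{n-1} c_n(k)x^k$ for $n\ge 1$. (i) For every odd $n\ge 1$, $R_{2n}(x)=(1-x^n)R_n(-x)$. (ii) For every odd $n\ge 1$ and every $k\ge 1$, $R_{2^kn}(x)=2^{k-1}\big(1-x^{2^{k-1}n}\big)R_n\big(-x^{2^{k-1}}\big)$.
   Context: For integers $n\ge 1$ and $k$, the Ramanujan sum is $c_n(k)=\sum_{1\le j\le n,\ \gcd(j,n)=1} e^{2\pi i jk/n}$. -}

module Defs where

open import Level using (Level; _⊔_)
open import Data.Nat using (ℕ; zero; suc; _≟_) renaming (_+_ to _+ℕ_; _*_ to _*ℕ_; _<_ to _<ℕ_)
open import Data.Nat.GCD using (gcd)
open import Data.Product using (_×_)
open import Data.Sum using (_⊎_)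
open import Relation.Nullary using (¬_; yes; no)
open import Algebra.Bundles using (CommutativeRing)

module _ {c ℓ : Level} (R : CommutativeRing c ℓ) where
  open CommutativeRing R

  pow : Carrier → ℕ → Carrier
  pow a zero    = 1#
  pow a (suc m) = a * pow a m

  sum1to : ℕ → (ℕ → Carrier) → Carrier
  sum1to zero    f = 0#
  sum1to (suc m) f = sum1to m f + f (suc m)

  sum0below : ℕ → (ℕ → Carrier) → Carrier
  sum0below zero    f = 0#
  sum0below (suc m) f = sum0below m f + f m

  IsDomain : Set (c ⊔ ℓ)
  IsDomain = (¬ (1# ≈ 0#)) × (∀ a b → a * b ≈ 0# → (a ≈ 0#) ⊎ (b ≈ 0#))

  -- ζ is a primitive n-th root of unity (the role of e^{2πi/n})
  IsPrimitiveRoot : Carrier → ℕ → Set ℓ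
  IsPrimitiveRoot ζ n = (pow ζ n ≈ 1#) × (∀ m → 0 <ℕ m → m <ℕ n → ¬ (pow ζ m ≈ 1#))

  ramanujan : (ζ : Carrier) → (n k : ℕ) → Carrier
  ramanujan ζ n k = sum1to n (λ j → term j (gcd j n ≟ 1))
    where
    term : (j : ℕ) → _ → Carrier
    term j (yes _) = pow ζ (j *ℕ k)
    term j (no _)  = 0#

  ramanujanPoly : (ζ : Carrier) → (n : ℕ) → Carrier → Carrier
  ramanujanPoly ζ n x = sum0below n (λ k → ramanujan ζ n k * pow x k)

{-# OPTIONS --safe #-}

-- The root of unity is abstract, so first: over a domain, c_n(k) does not depend on which
-- primitive n-th root is used. This follows by strong induction on n from
-- ∑_{j<n} η^{jk} = ∑_{d∣n} c_{n/d}(k) (computed with the root η^d), whose left side is n or 0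
-- whatever η is.
--
-- (i) If ω is a primitive 2n-th root with n odd, then ω^n = -1 and -ω is a primitive n-th root.
-- The units mod 2n are odd, so on them ω^{ju} = (-1)^u (-ω)^{ju}, and they are exactly one of
-- r, n + r for each unit r mod n; hence c_{2n}(u) = (-1)^u c_n(u). Splitting the 2n coefficients
-- of R_{2n} into two periods of c_n gives (1 - x^n) R_n(-x).
--
-- (ii) Write M = 2^{k-1} and j = t·2n + r. Since M has no prime factor outside 2n,
-- c_{2^k n}(m) = c_{2n}(m) ∑_{t<M} ω^{2nmt}, and this geometric sum is M or 0 according to
-- whether M ∣ m. So R_{2^k n}(x) = M·R_{2n}(x^M), computed with the root ω^M, and (i) applies.

module Submission where

open import Defs
open import Level using (Level; _⊔_)
open import Data.Nat using (ℕ; _≤_; _*_; _^_; _∸_)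
open import Data.Nat.Divisibility using (_∣_)
open import Data.Product using (_×_)
open import Relation.Nullary using (¬_)
open import Algebra.Bundles using (CommutativeRing)

import Data.Nat as ℕ
open import Data.Nat using (zero; suc; _<_; _≟_; s≤s; z<s; NonZero; ≢-nonZero; >-nonZero; >-nonZero⁻¹)
import Data.Nat.Properties as ℕₚ
open import Data.Nat.Properties
  using (*-cancelʳ-≡; *-monoʳ-<; m*n≢0; m^n≢0; m<m+n; <⇒≱; <⇒≢; ≤-refl; m<n⇒m<1+n; ≤∧≢⇒<; ≤-pred; n≢0⇒n>0)
open import Data.Nat.Divisibility
  using (divides; quotient; _∣?_; ∣-refl; ∣-trans; ∣⇒≤; _∣0; 0∣⇒≡0; ∣1⇒≡1; ∣m∣n⇒∣m+n; ∣m+n∣m⇒∣n;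
         m∣m*n; n∣m*n; *-cancelˡ-∣; *-cancelʳ-∣; quotient-<; m%n≡0⇒n∣m)
open import Data.Nat.DivMod using (_%_; _/_; m≡m%n+[m/n]*n; m%n<n)
open import Data.Nat.GCD
  using (gcd; gcd[m,n]∣m; gcd[m,n]∣n; gcd[m,n]≤n; gcd-GCD; gcd-identityˡ; c*gcd[m,n]≡gcd[cm,cn]; module GCD)
open import Data.Nat.Coprimality using (Coprime; coprime-divisor; coprime⇒gcd≡1; gcd≡1⇒coprime)
open import Data.Nat.Primality using (irreducible[2])
open import Data.Nat.Induction using (<-rec)
open import Data.Nat.Tactic.RingSolver using (solve-∀)
open import Data.Product using (_,_; proj₁; proj₂)
open import Data.Sum using (_⊎_; inj₁; inj₂)
open import Function using (_∘_; _⇔_; mk⇔; Equivalence)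
open import Function.Construct.Composition using (_⇔-∘_)
open import Relation.Nullary using (Dec; yes; no; contradiction)
open import Relation.Binary.PropositionalEquality as ≡ using (_≡_)

-- Parity and coprimality

odd⇒nonZero : ∀ {n} → ¬ 2 ∣ n → NonZero n
odd⇒nonZero 2∤n = ≢-nonZero (λ n≡0 → 2∤n (≡.subst (2 ∣_) (≡.sym n≡0) (2 ∣0)))

2∤⇒2∣suc : ∀ {n} → ¬ 2 ∣ n → 2 ∣ suc n
2∤⇒2∣suc {zero}        2∤0   = contradiction (2 ∣0) 2∤0
2∤⇒2∣suc {suc zero}    _     = divides 1 ≡.refl
2∤⇒2∣suc {suc (suc n)} 2∤2+n with 2∤⇒2∣suc (2∤2+n ∘ ∣m∣n⇒∣m+n ∣-refl)
... | divides q eq = divides (suc q) (≡.cong (2 ℕ.+_) eq)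

odd+odd⇒even : ∀ {m n} → ¬ 2 ∣ m → ¬ 2 ∣ n → 2 ∣ m ℕ.+ n
odd+odd⇒even {m} {n} 2∤m 2∤n = ∣m+n∣m⇒∣n 2∣2+[m+n] ∣-refl
  where
  2∣2+[m+n] : 2 ∣ 2 ℕ.+ (m ℕ.+ n)
  2∣2+[m+n] = ≡.subst (2 ∣_) (≡.cong suc (ℕₚ.+-suc m n)) (∣m∣n⇒∣m+n (2∤⇒2∣suc 2∤m) (2∤⇒2∣suc 2∤n))

odd+even⇒odd : ∀ {m n} → ¬ 2 ∣ m → 2 ∣ n → ¬ 2 ∣ m ℕ.+ n
odd+even⇒odd {m} {n} 2∤m 2∣n 2∣m+n = 2∤m (∣m+n∣m⇒∣n (≡.subst (2 ∣_) (ℕₚ.+-comm m n) 2∣m+n) 2∣n)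

coprime-∣ʳ : ∀ {x m n} → Coprime x m → n ∣ m → Coprime x n
coprime-∣ʳ x⊥m n∣m (d∣x , d∣n) = x⊥m (d∣x , ∣-trans d∣n n∣m)

coprime-* : ∀ {x m n} → Coprime x m → Coprime x n → Coprime x (m * n)
coprime-* {m = m} x⊥m x⊥n {d} (d∣x , d∣mn) = x⊥n (d∣x , coprime-divisor d⊥m d∣mn)
  where
  d⊥m : Coprime d m
  d⊥m (e∣d , e∣m) = x⊥m (∣-trans e∣d d∣x , e∣m)

coprime-^ : ∀ {x m} → Coprime x m → ∀ j → Coprime x (m ^ j)
coprime-^ x⊥m zero    (_ , d∣1) = ∣1⇒≡1 d∣1
coprime-^ x⊥m (suc j) = coprime-* x⊥m (coprime-^ x⊥m j)

coprime-+-∣⇔ : ∀ {a r m} → m ∣ a → Coprime (a ℕ.+ r) m ⇔ Coprime r m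
coprime-+-∣⇔ m∣a = mk⇔
  (λ c {_} (d∣r , d∣m) → c (∣m∣n⇒∣m+n (∣-trans d∣m m∣a) d∣r , d∣m))
  (λ c {_} (d∣a+r , d∣m) → c (∣m+n∣m⇒∣n d∣a+r (∣-trans d∣m m∣a) , d∣m))

odd⇒coprime-2 : ∀ {x} → ¬ 2 ∣ x → Coprime x 2
odd⇒coprime-2 2∤x (d∣x , d∣2) with irreducible[2] d∣2
... | inj₁ d≡1    = d≡1
... | inj₂ ≡.refl = contradiction d∣x 2∤x

coprime-2*⇔ : ∀ {x n} → ¬ 2 ∣ x → Coprime x (2 * n) ⇔ Coprime x n
coprime-2*⇔ {x} {n} 2∤x = mk⇔ to (coprime-* (odd⇒coprime-2 2∤x))
  where
  to : Coprime x (2 * n) → Coprime x n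
  to x⊥2n = coprime-∣ʳ x⊥2n (n∣m*n 2)

even⇒gcd≢1 : ∀ {x m} → 2 ∣ x → 2 ∣ m → ¬ gcd x m ≡ 1
even⇒gcd≢1 2∣x 2∣m g≡1 with gcd≡1⇒coprime g≡1 (2∣x , 2∣m)
... | ()

coprime-+-*⇔ : ∀ {M B} → (∀ {x} → Coprime x B → Coprime x M) →
               ∀ t r → Coprime (t * B ℕ.+ r) (M * B) ⇔ Coprime r B
coprime-+-*⇔ {M} {B} B⊥⇒M⊥ t r = mk⇔ to from
  where
  shift : Coprime (t * B ℕ.+ r) B ⇔ Coprime r B
  shift = coprime-+-∣⇔ (n∣m*n t)

  to : Coprime (t * B ℕ.+ r) (M * B) → Coprime r B
  to c = Equivalence.to shift (coprime-∣ʳ c (n∣m*n M))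

  from : Coprime r B → Coprime (t * B ℕ.+ r) (M * B)
  from c = coprime-* (B⊥⇒M⊥ c′) c′
    where
    c′ : Coprime (t * B ℕ.+ r) B
    c′ = Equivalence.from shift c

gcd[n,n]≡gcd[0,n] : ∀ n → gcd n n ≡ gcd 0 n
gcd[n,n]≡gcd[0,n] n = ≡.trans (GCD.unique (gcd-GCD n n) GCD.refl) (≡.sym (gcd-identityˡ n))

gcd[m*d,n*d]≡d⇔gcd[m,n]≡1 : ∀ m n d .{{_ : NonZero d}} → gcd (m * d) (n * d) ≡ d ⇔ gcd m n ≡ 1
gcd[m*d,n*d]≡d⇔gcd[m,n]≡1 m n d = mk⇔
  (λ e → *-cancelʳ-≡ (gcd m n) 1 d (≡.trans (≡.sym gcd-*) (≡.trans e (≡.sym (ℕₚ.*-identityˡ d)))))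
  (λ e → ≡.trans gcd-* (≡.trans (≡.cong (_* d) e) (ℕₚ.*-identityˡ d)))
  where
  gcd-* : gcd (m * d) (n * d) ≡ gcd m n * d
  gcd-* = ≡.trans (≡.cong₂ gcd (ℕₚ.*-comm m d) (ℕₚ.*-comm n d))
                  (≡.trans (≡.sym (c*gcd[m,n]≡gcd[cm,cn] d m n)) (ℕₚ.*-comm d (gcd m n)))

module _ {c ℓ : Level} (R : CommutativeRing c ℓ) where
  open CommutativeRing R renaming (_*_ to _·_)
  open import Algebra.Properties.Ring ring
    using (-1*x≈-x; -‿involutive; ⁻¹-anti-homo‿-; [y-z]x≈yx-zx;
           +-cancelˡ; +-cancelʳ; +-inverseˡ-unique; x∙y⁻¹≈ε⇒x≈y; x≈y⇒x∙y⁻¹≈ε)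
  open import Algebra.Properties.CommutativeSemigroup +-commutativeSemigroup
    using () renaming (interchange to +-interchange)
  open import Algebra.Properties.CommutativeSemigroup *-commutativeSemigroup
    using () renaming (interchange to *-interchange; xy∙z≈y∙xz to xy*z≈y*xz; x∙yz≈y∙xz to x*yz≈y*xz)
  open import Algebra.Properties.Semiring.Mult semiring using (×1-homo-*) renaming (_×_ to _×ᴿ_)
  open import Relation.Binary.Reasoning.Setoid setoid

  -- Powers

  infixr 8 _^ᴿ_
  _^ᴿ_ : Carrier → ℕ → Carrier
  _^ᴿ_ = pow R

  pow-congˡ : ∀ {x y} n → x ≈ y → x ^ᴿ n ≈ y ^ᴿ n
  pow-congˡ zero    _   = refl
  pow-congˡ (suc n) x≈y = *-cong x≈y (pow-congˡ n x≈y)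

  pow-homo-* : ∀ x m n → x ^ᴿ (m ℕ.+ n) ≈ x ^ᴿ m · x ^ᴿ n
  pow-homo-* x zero    n = sym (*-identityˡ _)
  pow-homo-* x (suc m) n = trans (*-congˡ (pow-homo-* x m n)) (sym (*-assoc x _ _))

  pow-1# : ∀ n → 1# ^ᴿ n ≈ 1#
  pow-1# zero    = refl
  pow-1# (suc n) = trans (*-identityˡ _) (pow-1# n)

  pow-distrib-· : ∀ x y n → (x · y) ^ᴿ n ≈ x ^ᴿ n · y ^ᴿ n
  pow-distrib-· x y zero    = sym (*-identityˡ 1#)
  pow-distrib-· x y (suc n) = trans (*-congˡ (pow-distrib-· x y n)) (*-interchange x y _ _)

  pow-assocʳ : ∀ x m n → (x ^ᴿ m) ^ᴿ n ≈ x ^ᴿ (m * n)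
  pow-assocʳ x zero    n = pow-1# n
  pow-assocʳ x (suc m) n = begin
    (x · x ^ᴿ m) ^ᴿ n            ≈⟨ pow-distrib-· x (x ^ᴿ m) n ⟩
    x ^ᴿ n · (x ^ᴿ m) ^ᴿ n       ≈⟨ *-congˡ (pow-assocʳ x m n) ⟩
    x ^ᴿ n · x ^ᴿ (m * n)        ≈⟨ pow-homo-* x n (m * n) ⟨
    x ^ᴿ (n ℕ.+ m * n)           ∎

  pow-∣≈1 : ∀ {x n a} → x ^ᴿ n ≈ 1# → n ∣ a → x ^ᴿ a ≈ 1#
  pow-∣≈1 {x} {n} xⁿ≈1 (divides q ≡.refl) = begin
    x ^ᴿ (q * n)     ≡⟨ ≡.cong (x ^ᴿ_) (ℕₚ.*-comm q n) ⟩
    x ^ᴿ (n * q)     ≈⟨ pow-assocʳ x n q ⟨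
    (x ^ᴿ n) ^ᴿ q    ≈⟨ pow-congˡ q xⁿ≈1 ⟩
    1# ^ᴿ q          ≈⟨ pow-1# q ⟩
    1#               ∎

  pow-+-∣ : ∀ {x n a} b → x ^ᴿ n ≈ 1# → n ∣ a → x ^ᴿ (a ℕ.+ b) ≈ x ^ᴿ b
  pow-+-∣ {x} {a = a} b xⁿ≈1 n∣a =
    trans (pow-homo-* x a b) (trans (*-congʳ (pow-∣≈1 xⁿ≈1 n∣a)) (*-identityˡ _))

  pow-neg : ∀ x n → (- x) ^ᴿ n ≈ (- 1#) ^ᴿ n · x ^ᴿ n
  pow-neg x n = trans (pow-congˡ n (sym (-1*x≈-x x))) (pow-distrib-· (- 1#) x n)

  pow-neg1-even : ∀ {n} → 2 ∣ n → (- 1#) ^ᴿ n ≈ 1#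
  pow-neg1-even = pow-∣≈1 (trans (*-congˡ (*-identityʳ (- 1#))) (trans (-1*x≈-x (- 1#)) (-‿involutive 1#)))

  pow-neg1-odd : ∀ {n} → ¬ 2 ∣ n → (- 1#) ^ᴿ n ≈ - 1#
  pow-neg1-odd {n} 2∤n = begin
    (- 1#) ^ᴿ n          ≈⟨ -‿involutive _ ⟨
    - (- (- 1#) ^ᴿ n)    ≈⟨ -‿cong (trans (sym (-1*x≈-x _)) (pow-neg1-even (2∤⇒2∣suc 2∤n))) ⟩
    - 1#                 ∎

  pow-neg-even : ∀ x {n} → 2 ∣ n → (- x) ^ᴿ n ≈ x ^ᴿ n
  pow-neg-even x {n} 2∣n = trans (pow-neg x n) (trans (*-congʳ (pow-neg1-even 2∣n)) (*-identityˡ _))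

  pow-neg-odd : ∀ x {n} → ¬ 2 ∣ n → (- x) ^ᴿ n ≈ - x ^ᴿ n
  pow-neg-odd x {n} 2∤n = trans (pow-neg x n) (trans (*-congʳ (pow-neg1-odd 2∤n)) (-1*x≈-x _))

  2^k×1≈[1+1]^k : ∀ k → (2 ^ k) ×ᴿ 1# ≈ (1# + 1#) ^ᴿ k
  2^k×1≈[1+1]^k zero    = +-identityʳ 1#
  2^k×1≈[1+1]^k (suc k) = trans (×1-homo-* 2 (2 ^ k)) (*-cong (+-congˡ (+-identityʳ 1#)) (2^k×1≈[1+1]^k k))

  +-telescope : ∀ u v w → (u - w) + (v - u) ≈ v - w
  +-telescope u v w = begin
    (u - w) + (v - u)      ≈⟨ +-comm _ _ ⟩
    (v - u) + (u - w)      ≈⟨ +-assoc v (- u) _ ⟩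
    v + (- u + (u - w))    ≈⟨ +-congˡ (+-assoc (- u) u (- w)) ⟨
    v + ((- u + u) - w)    ≈⟨ +-congˡ (+-congʳ (-‿inverseˡ u)) ⟩
    v + (0# - w)           ≈⟨ +-congˡ (+-identityˡ (- w)) ⟩
    v - w                  ∎

  -- Finite sums

  Σ< : ℕ → (ℕ → Carrier) → Carrier
  Σ< = sum0below R

  infix 6.5 Σ<
  syntax Σ< n (λ i → e) = ∑[ i < n ] e

  sum0below-cong : ∀ n {f g} → (∀ i → i < n → f i ≈ g i) → Σ< n f ≈ Σ< n g
  sum0below-cong zero    _   = refl
  sum0below-cong (suc n) f≈g = +-cong (sum0below-cong n (λ i i<n → f≈g i (m<n⇒m<1+n i<n))) (f≈g n ≤-refl)

  sum1to-cong : ∀ n {f g} → (∀ j → f j ≈ g j) → sum1to R n f ≈ sum1to R n g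
  sum1to-cong zero    _   = refl
  sum1to-cong (suc n) f≈g = +-cong (sum1to-cong n f≈g) (f≈g (suc n))

  sum0below-zero : ∀ n {f} → (∀ i → i < n → f i ≈ 0#) → Σ< n f ≈ 0#
  sum0below-zero n f≈0 = trans (sum0below-cong n f≈0) (zeros n)
    where
    zeros : ∀ m → ∑[ i < m ] 0# ≈ 0#
    zeros zero    = refl
    zeros (suc m) = trans (+-identityʳ _) (zeros m)

  sum0below-const : ∀ n x → ∑[ i < n ] x ≈ n ×ᴿ x
  sum0below-const zero    x = refl
  sum0below-const (suc n) x = trans (+-comm _ x) (+-congˡ (sum0below-const n x))

  sum0below-distrib-+ : ∀ n f g → ∑[ i < n ] (f i + g i) ≈ Σ< n f + Σ< n g
  sum0below-distrib-+ zero    f g = sym (+-identityʳ 0#)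
  sum0below-distrib-+ (suc n) f g = trans (+-congʳ (sum0below-distrib-+ n f g)) (+-interchange _ _ _ _)

  *-distribˡ-sum0below : ∀ n x f → x · Σ< n f ≈ ∑[ i < n ] (x · f i)
  *-distribˡ-sum0below zero    x f = zeroʳ x
  *-distribˡ-sum0below (suc n) x f = trans (distribˡ x _ _) (+-congʳ (*-distribˡ-sum0below n x f))

  *-distribʳ-sum0below : ∀ n x f → Σ< n f · x ≈ ∑[ i < n ] (f i · x)
  *-distribʳ-sum0below zero    x f = zeroˡ x
  *-distribʳ-sum0below (suc n) x f = trans (distribʳ x _ _) (+-congʳ (*-distribʳ-sum0below n x f))

  sum0below-suc : ∀ n f → Σ< (suc n) f ≈ f 0 + ∑[ i < n ] f (suc i)
  sum0below-suc zero    f = trans (+-identityˡ _) (sym (+-identityʳ _))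
  sum0below-suc (suc n) f = trans (+-congʳ (sum0below-suc n f)) (+-assoc _ _ _)

  sum0below-+ : ∀ m n f → Σ< (m ℕ.+ n) f ≈ Σ< m f + ∑[ i < n ] f (m ℕ.+ i)
  sum0below-+ m zero    f = trans (reflexive (≡.cong (λ k → Σ< k f) (ℕₚ.+-identityʳ m))) (sym (+-identityʳ _))
  sum0below-+ m (suc n) f = begin
    Σ< (m ℕ.+ suc n) f                                     ≡⟨ ≡.cong (λ k → Σ< k f) (ℕₚ.+-suc m n) ⟩
    Σ< (m ℕ.+ n) f + f (m ℕ.+ n)                           ≈⟨ +-congʳ (sum0below-+ m n f) ⟩
    (Σ< m f + ∑[ i < n ] f (m ℕ.+ i)) + f (m ℕ.+ n)        ≈⟨ +-assoc _ _ _ ⟩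
    Σ< m f + ∑[ i < suc n ] f (m ℕ.+ i)                    ∎

  sum0below-comm : ∀ m n (f : ℕ → ℕ → Carrier) → ∑[ i < m ] ∑[ j < n ] f i j ≈ ∑[ j < n ] ∑[ i < m ] f i j
  sum0below-comm zero    n f = sym (sum0below-zero n (λ _ _ → refl))
  sum0below-comm (suc m) n f = trans (+-congʳ (sum0below-comm m n f)) (sym (sum0below-distrib-+ n _ _))

  sum0below-blocks : ∀ M B (f : ℕ → Carrier) → Σ< (M * B) f ≈ ∑[ t < M ] ∑[ r < B ] f (t * B ℕ.+ r)
  sum0below-blocks zero    B f = refl
  sum0below-blocks (suc M) B f = begin
    Σ< (B ℕ.+ M * B) f                                      ≈⟨ sum0below-+ B (M * B) f ⟩
    Σ< B f + ∑[ j < M * B ] f (B ℕ.+ j)                     ≈⟨ +-congˡ (sum0below-blocks M B _) ⟩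
    Σ< B f + ∑[ t < M ] ∑[ r < B ] f (B ℕ.+ (t * B ℕ.+ r))  ≈⟨ +-congˡ (sum0below-cong M λ t _ → sum0below-cong B λ r _ →
                                                                  reflexive (≡.cong f (≡.sym (ℕₚ.+-assoc B (t * B) r)))) ⟩
    Σ< B f + ∑[ t < M ] ∑[ r < B ] f (suc t * B ℕ.+ r)      ≈⟨ sum0below-suc M _ ⟨
    ∑[ t < suc M ] ∑[ r < B ] f (t * B ℕ.+ r)               ∎

  sum0below-multiples : ∀ q d .{{_ : NonZero d}} (f : ℕ → Carrier) → (∀ j → ¬ d ∣ j → f j ≈ 0#) →
                        Σ< (q * d) f ≈ ∑[ i < q ] f (i * d)
  sum0below-multiples q d@(suc d′) f f-off =
    trans (sum0below-blocks q d f) (sum0below-cong q (λ i _ → block i))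
    where
    block : ∀ i → ∑[ r < d ] f (i * d ℕ.+ r) ≈ f (i * d)
    block i = begin
      ∑[ r < d ] f (i * d ℕ.+ r)                               ≈⟨ sum0below-suc d′ _ ⟩
      f (i * d ℕ.+ 0) + ∑[ r < d′ ] f (i * d ℕ.+ suc r)       ≈⟨ +-cong (reflexive (≡.cong f (ℕₚ.+-identityʳ _)))
                                                                         (sum0below-zero d′ λ r r<d′ → f-off _ (d∤ r r<d′)) ⟩
      f (i * d) + 0#                                           ≈⟨ +-identityʳ _ ⟩
      f (i * d)                                                ∎
      where
      d∤ : ∀ r → r < d′ → ¬ d ∣ i * d ℕ.+ suc r
      d∤ r r<d′ d∣ = <⇒≱ (s≤s r<d′) (∣⇒≤ (∣m+n∣m⇒∣n d∣ (n∣m*n i)))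

  sum1to≈sum0below : ∀ n {f} → f n ≈ f 0 → sum1to R n f ≈ Σ< n f
  sum1to≈sum0below n {f} fn≈f0 = +-cancelˡ (f 0) _ _ (begin
    f 0 + sum1to R n f  ≈⟨ shift n ⟩
    Σ< n f + f n        ≈⟨ +-congˡ fn≈f0 ⟩
    Σ< n f + f 0        ≈⟨ +-comm _ _ ⟩
    f 0 + Σ< n f        ∎)
    where
    shift : ∀ m → f 0 + sum1to R m f ≈ Σ< m f + f m
    shift zero    = +-comm _ _
    shift (suc m) = trans (sym (+-assoc _ _ _)) (+-congʳ (shift m))

  powerSum≈geometric : ∀ ξ n k → ∑[ j < n ] ξ ^ᴿ (j * k) ≈ Σ< n ((ξ ^ᴿ k) ^ᴿ_)
  powerSum≈geometric ξ n k = sum0below-cong n λ j _ →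
    trans (reflexive (≡.cong (ξ ^ᴿ_) (ℕₚ.*-comm j k))) (sym (pow-assocʳ ξ k j))

  geometric-sum : ∀ a m → (a - 1#) · Σ< m (a ^ᴿ_) ≈ a ^ᴿ m - 1#
  geometric-sum a zero    = trans (zeroʳ _) (sym (-‿inverseʳ 1#))
  geometric-sum a (suc m) = begin
    (a - 1#) · (Σ< m (a ^ᴿ_) + a ^ᴿ m)                ≈⟨ distribˡ _ _ _ ⟩
    (a - 1#) · Σ< m (a ^ᴿ_) + (a - 1#) · a ^ᴿ m       ≈⟨ +-cong (geometric-sum a m) ([y-z]x≈yx-zx (a ^ᴿ m) a 1#) ⟩
    (a ^ᴿ m - 1#) + (a · a ^ᴿ m - 1# · a ^ᴿ m)        ≈⟨ +-congˡ (+-congˡ (-‿cong (*-identityˡ _))) ⟩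
    (a ^ᴿ m - 1#) + (a · a ^ᴿ m - a ^ᴿ m)             ≈⟨ +-telescope _ _ _ ⟩
    a · a ^ᴿ m - 1#                                   ∎

  select : ∀ {p} {A : Set p} → Dec A → Carrier → Carrier
  select (yes _) x = x
  select (no _)  _ = 0#

  select-cong : ∀ {p q} {A : Set p} {B : Set q} (a? : Dec A) (b? : Dec B) {x y} →
                A ⇔ B → x ≈ y → select a? x ≈ select b? y
  select-cong (yes _) (yes _) _   x≈y = x≈y
  select-cong (yes a) (no ¬b) A⇔B _   = contradiction (Equivalence.to A⇔B a) ¬b
  select-cong (no ¬a) (yes b) A⇔B _   = contradiction (Equivalence.from A⇔B b) ¬a
  select-cong (no _)  (no _)  _   _   = refl

  select-congʳ : ∀ {p} {A : Set p} (a? : Dec A) {x y} → x ≈ y → select a? x ≈ select a? y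
  select-congʳ (yes _) x≈y = x≈y
  select-congʳ (no _)  _   = refl

  select-¬ : ∀ {p} {A : Set p} (a? : Dec A) {x} → ¬ A → select a? x ≈ 0#
  select-¬ (yes a) ¬a = contradiction a ¬a
  select-¬ (no _)  _  = refl

  *-distribˡ-select : ∀ {p} {A : Set p} (a? : Dec A) x y → x · select a? y ≈ select a? (x · y)
  *-distribˡ-select (yes _) x y = refl
  *-distribˡ-select (no _)  x y = zeroʳ x

  select-coprime-cong : ∀ {a m b n x y} → Coprime a m ⇔ Coprime b n → x ≈ y →
                        select (gcd a m ≟ 1) x ≈ select (gcd b n ≟ 1) y
  select-coprime-cong {a} {m} {b} {n} am⇔bn = select-cong (gcd a m ≟ 1) (gcd b n ≟ 1) (mk⇔
    (coprime⇒gcd≡1 ∘ Equivalence.to am⇔bn ∘ gcd≡1⇒coprime)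
    (coprime⇒gcd≡1 ∘ Equivalence.from am⇔bn ∘ gcd≡1⇒coprime))

  sum0below-select-≟ : ∀ {g} m x → g < m → ∑[ d < m ] select (g ≟ d) x ≈ x
  sum0below-select-≟ {g} (suc m) x g<1+m with g ≟ m
  ... | yes ≡.refl = trans (+-congʳ (sum0below-zero m (λ d d<g → select-¬ (g ≟ d) (<⇒≢ d<g ∘ ≡.sym)))) (+-identityˡ x)
  ... | no  g≢m    = trans (+-identityʳ _) (sum0below-select-≟ m x (≤∧≢⇒< (≤-pred g<1+m) g≢m))

  sum0below-partition-gcd : ∀ n .{{_ : NonZero n}} f →
                            Σ< n f ≈ ∑[ d < suc n ] ∑[ j < n ] select (gcd j n ≟ d) (f j)
  sum0below-partition-gcd n f = trans
    (sum0below-cong n (λ j _ → sym (sum0below-select-≟ (suc n) (f j) (s≤s (gcd[m,n]≤n j n)))))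
    (sum0below-comm n (suc n) _)

  -- Ramanujan sums

  gcdClassSum : Carrier → ℕ → ℕ → ℕ → Carrier
  gcdClassSum η n k d = ∑[ j < n ] select (gcd j n ≟ d) (η ^ᴿ (j * k))

  ramanujan-unfold : ∀ η n k → ramanujan R η n k ≈ sum1to R n (λ j → select (gcd j n ≟ 1) (η ^ᴿ (j * k)))
  ramanujan-unfold η n k = sum1to-cong n summand≈
    where
    -- The summand of `ramanujan` is local to its definition; it is named here by unification.
    summandOf : ∀ {F : ℕ → Carrier} → sum1to R n F ≡ sum1to R n F → ℕ → Carrier
    summandOf {F} _ = F

    summand : ℕ → Carrier
    summand = summandOf (≡.refl {x = ramanujan R η n k})

    summand≈ : ∀ j → summand j ≈ select (gcd j n ≟ 1) (η ^ᴿ (j * k))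
    summand≈ j with gcd j n ≟ 1
    ... | yes _ = refl
    ... | no  _ = refl

  ramanujan≈gcdClassSum : ∀ η n k → η ^ᴿ n ≈ 1# → ramanujan R η n k ≈ gcdClassSum η n k 1
  ramanujan≈gcdClassSum η n k ηⁿ≈1 = trans (ramanujan-unfold η n k) (sum1to≈sum0below n last≈first)
    where
    gcd≡1⇔ : gcd n n ≡ 1 ⇔ gcd 0 n ≡ 1
    gcd≡1⇔ = mk⇔ (≡.trans (≡.sym (gcd[n,n]≡gcd[0,n] n))) (≡.trans (gcd[n,n]≡gcd[0,n] n))

    last≈first : select (gcd n n ≟ 1) (η ^ᴿ (n * k)) ≈ select (gcd 0 n ≟ 1) 1#
    last≈first = select-cong (gcd n n ≟ 1) (gcd 0 n ≟ 1) gcd≡1⇔ (pow-∣≈1 ηⁿ≈1 (m∣m*n {n} k))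

  gcdClassSum-cong : ∀ {η η′} n k d → η ≈ η′ → gcdClassSum η n k d ≈ gcdClassSum η′ n k d
  gcdClassSum-cong n k d η≈η′ = sum0below-cong n (λ j _ → select-congʳ (gcd j n ≟ d) (pow-congˡ (j * k) η≈η′))

  gcdClassSum-pow : ∀ {η} n k e d → gcdClassSum η n (k * e) d ≈ gcdClassSum (η ^ᴿ e) n k d
  gcdClassSum-pow {η} n k e d = sum0below-cong n λ j _ → select-congʳ (gcd j n ≟ d) (begin
    η ^ᴿ (j * (k * e))     ≡⟨ ≡.cong (η ^ᴿ_) (exponent j k e) ⟩
    η ^ᴿ (e * (j * k))     ≈⟨ pow-assocʳ η e (j * k) ⟨
    (η ^ᴿ e) ^ᴿ (j * k)    ∎)
    where
    exponent : ∀ j k e → j * (k * e) ≡ e * (j * k)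
    exponent = solve-∀

  gcdClassSum-periodic : ∀ η n k d → η ^ᴿ n ≈ 1# → gcdClassSum η n (n ℕ.+ k) d ≈ gcdClassSum η n k d
  gcdClassSum-periodic η n k d ηⁿ≈1 = sum0below-cong n λ j _ → select-congʳ (gcd j n ≟ d) (begin
    η ^ᴿ (j * (n ℕ.+ k))          ≡⟨ ≡.cong (η ^ᴿ_) (ℕₚ.*-distribˡ-+ j n k) ⟩
    η ^ᴿ (j * n ℕ.+ j * k)        ≈⟨ pow-+-∣ (j * k) ηⁿ≈1 (n∣m*n j) ⟩
    η ^ᴿ (j * k)                  ∎)

  ramanujan-periodic : ∀ ξ n k → ξ ^ᴿ n ≈ 1# → ramanujan R ξ n (n ℕ.+ k) ≈ ramanujan R ξ n k
  ramanujan-periodic ξ n k ξⁿ≈1 = begin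
    ramanujan R ξ n (n ℕ.+ k)        ≈⟨ ramanujan≈gcdClassSum ξ n _ ξⁿ≈1 ⟩
    gcdClassSum ξ n (n ℕ.+ k) 1      ≈⟨ gcdClassSum-periodic ξ n k 1 ξⁿ≈1 ⟩
    gcdClassSum ξ n k 1              ≈⟨ ramanujan≈gcdClassSum ξ n k ξⁿ≈1 ⟨
    ramanujan R ξ n k                ∎

  gcdClassSum-∤ : ∀ {η n d} k → ¬ d ∣ n → gcdClassSum η n k d ≈ 0#
  gcdClassSum-∤ {n = n} k d∤n =
    sum0below-zero n (λ j _ → select-¬ (gcd j n ≟ _) (λ g≡d → d∤n (≡.subst (_∣ n) g≡d (gcd[m,n]∣n j n))))

  gcdClassSum-divisor : ∀ {η n d} k .{{_ : NonZero d}} (d∣n : d ∣ n) →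
                        gcdClassSum η n k d ≈ gcdClassSum (η ^ᴿ d) (quotient d∣n) k 1
  gcdClassSum-divisor {η} {d = d} k (divides q ≡.refl) =
    trans (sum0below-multiples q d f f-off) (sum0below-cong q λ i _ →
      select-cong (gcd (i * d) (q * d) ≟ d) (gcd i q ≟ 1) (gcd[m*d,n*d]≡d⇔gcd[m,n]≡1 i q d) (value i))
    where
    f : ℕ → Carrier
    f j = select (gcd j (q * d) ≟ d) (η ^ᴿ (j * k))

    f-off : ∀ j → ¬ d ∣ j → f j ≈ 0#
    f-off j d∤j = select-¬ (gcd j (q * d) ≟ d) (λ g≡d → d∤j (≡.subst (_∣ j) g≡d (gcd[m,n]∣m j (q * d))))

    value : ∀ i → η ^ᴿ (i * d * k) ≈ (η ^ᴿ d) ^ᴿ (i * k)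
    value i = trans (reflexive (≡.cong (η ^ᴿ_) (exponent i d k))) (sym (pow-assocʳ η d (i * k)))
      where
      exponent : ∀ i d k → i * d * k ≡ d * (i * k)
      exponent = solve-∀

  -- Roots of unity

  primitive⇒∣ : ∀ {η n a} .{{_ : NonZero n}} → IsPrimitiveRoot R η n → η ^ᴿ a ≈ 1# → n ∣ a
  primitive⇒∣ {η} {n} {a} (ηⁿ≈1 , minimal) ηᵃ≈1 with a % n ≟ 0
  ... | yes a%n≡0 = m%n≡0⇒n∣m a n a%n≡0
  ... | no  a%n≢0 = contradiction ηʳ≈1 (minimal (a % n) (n≢0⇒n>0 a%n≢0) (m%n<n a n))
    where
    ηʳ≈1 : η ^ᴿ (a % n) ≈ 1#
    ηʳ≈1 = begin
      η ^ᴿ (a % n)                        ≈⟨ *-identityʳ _ ⟨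
      η ^ᴿ (a % n) · 1#                   ≈⟨ *-congˡ (pow-∣≈1 ηⁿ≈1 (n∣m*n (a / n))) ⟨
      η ^ᴿ (a % n) · η ^ᴿ (a / n * n)     ≈⟨ pow-homo-* η (a % n) (a / n * n) ⟨
      η ^ᴿ (a % n ℕ.+ a / n * n)          ≡⟨ ≡.cong (η ^ᴿ_) (m≡m%n+[m/n]*n a n) ⟨
      η ^ᴿ a                              ≈⟨ ηᵃ≈1 ⟩
      1#                                  ∎

  IsPrimitiveRoot-pow : ∀ {η n e} .{{_ : NonZero e}} (e∣n : e ∣ n) →
                        IsPrimitiveRoot R η n → IsPrimitiveRoot R (η ^ᴿ e) (quotient e∣n)
  IsPrimitiveRoot-pow {η} {e = e} (divides q ≡.refl) (ηⁿ≈1 , minimal) = root , minimal′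
    where
    root : (η ^ᴿ e) ^ᴿ q ≈ 1#
    root = trans (pow-assocʳ η e q) (trans (reflexive (≡.cong (η ^ᴿ_) (ℕₚ.*-comm e q))) ηⁿ≈1)

    minimal′ : ∀ m → 0 < m → m < q → ¬ (η ^ᴿ e) ^ᴿ m ≈ 1#
    minimal′ m@(suc _) _ m<q ηᵉᵐ≈1 = minimal (e * m) (>-nonZero⁻¹ (e * m) {{m*n≢0 e m}})
      (≡.subst (e * m <_) (ℕₚ.*-comm e q) (*-monoʳ-< e m<q)) (trans (sym (pow-assocʳ η e m)) ηᵉᵐ≈1)

  neg-pow-odd≈1 : ∀ {ω n} → ¬ 2 ∣ n → ω ^ᴿ n ≈ - 1# → (- ω) ^ᴿ n ≈ 1#
  neg-pow-odd≈1 {ω} 2∤n ωⁿ≈-1 = trans (pow-neg-odd ω 2∤n) (trans (-‿cong ωⁿ≈-1) (-‿involutive 1#))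

  neg-IsPrimitiveRoot : ∀ {ω n} → ¬ 2 ∣ n → IsPrimitiveRoot R ω (2 * n) → ω ^ᴿ n ≈ - 1# →
                        IsPrimitiveRoot R (- ω) n
  neg-IsPrimitiveRoot {ω} {n} 2∤n ω-prim ωⁿ≈-1 = neg-pow-odd≈1 2∤n ωⁿ≈-1 , minimal
    where
    instance
      n≢0 : NonZero n
      n≢0 = odd⇒nonZero 2∤n

    minimal : ∀ m → 0 < m → m < n → ¬ (- ω) ^ᴿ m ≈ 1#
    minimal m 0<m m<n [-ω]ᵐ≈1 = <⇒≱ m<n (∣⇒≤ {{>-nonZero 0<m}} n∣m)
      where
      ω²ᵐ≈1 : ω ^ᴿ (2 * m) ≈ 1#
      ω²ᵐ≈1 = begin
        ω ^ᴿ (2 * m)          ≈⟨ pow-neg-even ω (m∣m*n m) ⟨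
        (- ω) ^ᴿ (2 * m)      ≡⟨ ≡.cong ((- ω) ^ᴿ_) (ℕₚ.*-comm 2 m) ⟩
        (- ω) ^ᴿ (m * 2)      ≈⟨ pow-assocʳ (- ω) m 2 ⟨
        ((- ω) ^ᴿ m) ^ᴿ 2     ≈⟨ pow-congˡ 2 [-ω]ᵐ≈1 ⟩
        1# ^ᴿ 2               ≈⟨ pow-1# 2 ⟩
        1#                    ∎

      n∣m : n ∣ m
      n∣m = *-cancelˡ-∣ 2 (primitive⇒∣ {{m*n≢0 2 n}} ω-prim ω²ᵐ≈1)

  -- Moduli 2n and 2^k n

  select-coprime-double : ∀ {n} → ¬ 2 ∣ n → ∀ r x →
    select (gcd r (2 * n) ≟ 1) x + select (gcd (n ℕ.+ r) (2 * n) ≟ 1) x ≈ select (gcd r n ≟ 1) x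
  select-coprime-double {n} 2∤n r x with 2 ∣? r
  ... | yes 2∣r = trans (+-congʳ (select-¬ (gcd r (2 * n) ≟ 1) (even⇒gcd≢1 2∣r (m∣m*n n))))
                        (trans (+-identityˡ _) (select-coprime-cong {n ℕ.+ r} {2 * n} {r} {n} n+r⇔r refl))
    where
    n+r⇔r : Coprime (n ℕ.+ r) (2 * n) ⇔ Coprime r n
    n+r⇔r = coprime-+-∣⇔ ∣-refl ⇔-∘ coprime-2*⇔ (odd+even⇒odd 2∤n 2∣r)
  ... | no  2∤r = trans (+-congˡ (select-¬ (gcd (n ℕ.+ r) (2 * n) ≟ 1) (even⇒gcd≢1 (odd+odd⇒even 2∤n 2∤r) (m∣m*n n))))
                        (trans (+-identityʳ _) (select-coprime-cong (coprime-2*⇔ 2∤r) refl))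

  gcdClassSum-double : ∀ {ξ n} u → ¬ 2 ∣ n → ξ ^ᴿ n ≈ 1# → gcdClassSum ξ (2 * n) u 1 ≈ gcdClassSum ξ n u 1
  gcdClassSum-double {ξ} {n} u 2∤n ξⁿ≈1 = begin
    Σ< (2 * n) f                          ≡⟨ ≡.cong (λ m → Σ< (n ℕ.+ m) f) (ℕₚ.+-identityʳ n) ⟩
    Σ< (n ℕ.+ n) f                        ≈⟨ sum0below-+ n n f ⟩
    Σ< n f + ∑[ r < n ] f (n ℕ.+ r)       ≈⟨ sum0below-distrib-+ n f _ ⟨
    ∑[ r < n ] (f r + f (n ℕ.+ r))        ≈⟨ sum0below-cong n (λ r _ → pair r) ⟩
    gcdClassSum ξ n u 1                   ∎
    where
    f : ℕ → Carrier
    f j = select (gcd j (2 * n) ≟ 1) (ξ ^ᴿ (j * u))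

    pair : ∀ r → f r + f (n ℕ.+ r) ≈ select (gcd r n ≟ 1) (ξ ^ᴿ (r * u))
    pair r = trans (+-congˡ (select-congʳ (gcd (n ℕ.+ r) (2 * n) ≟ 1) shifted)) (select-coprime-double 2∤n r _)
      where
      shifted : ξ ^ᴿ ((n ℕ.+ r) * u) ≈ ξ ^ᴿ (r * u)
      shifted = trans (reflexive (≡.cong (ξ ^ᴿ_) (ℕₚ.*-distribʳ-+ u n r))) (pow-+-∣ (r * u) ξⁿ≈1 (m∣m*n {n} u))

  gcdClassSum-neg : ∀ {ω m} u → 2 ∣ m → gcdClassSum (- ω) m u 1 ≈ (- 1#) ^ᴿ u · gcdClassSum ω m u 1
  gcdClassSum-neg {ω} {m} u 2∣m =
    trans (sum0below-cong m (λ j _ → term j)) (sym (*-distribˡ-sum0below m _ _))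
    where
    term : ∀ j → select (gcd j m ≟ 1) ((- ω) ^ᴿ (j * u)) ≈ (- 1#) ^ᴿ u · select (gcd j m ≟ 1) (ω ^ᴿ (j * u))
    term j with gcd j m ≟ 1
    ... | no  _   = sym (zeroʳ _)
    ... | yes g≡1 = begin
      (- ω) ^ᴿ (j * u)                ≈⟨ pow-assocʳ (- ω) j u ⟨
      ((- ω) ^ᴿ j) ^ᴿ u               ≈⟨ pow-congˡ u (pow-neg-odd ω {j} (λ 2∣j → even⇒gcd≢1 2∣j 2∣m g≡1)) ⟩
      (- ω ^ᴿ j) ^ᴿ u                 ≈⟨ pow-neg (ω ^ᴿ j) u ⟩
      (- 1#) ^ᴿ u · (ω ^ᴿ j) ^ᴿ u     ≈⟨ *-congˡ (pow-assocʳ ω j u) ⟩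
      (- 1#) ^ᴿ u · ω ^ᴿ (j * u)      ∎

  ramanujan-double : ∀ {ω n} u → ¬ 2 ∣ n → ω ^ᴿ (2 * n) ≈ 1# → ω ^ᴿ n ≈ - 1# →
                     ramanujan R ω (2 * n) u ≈ (- 1#) ^ᴿ u · ramanujan R (- ω) n u
  ramanujan-double {ω} {n} u 2∤n ω²ⁿ≈1 ωⁿ≈-1 = begin
    ramanujan R ω (2 * n) u                           ≈⟨ ramanujan≈gcdClassSum ω (2 * n) u ω²ⁿ≈1 ⟩
    gcdClassSum ω (2 * n) u 1                         ≈⟨ gcdClassSum-cong (2 * n) u 1 (-‿involutive ω) ⟨
    gcdClassSum (- (- ω)) (2 * n) u 1                 ≈⟨ gcdClassSum-neg u (m∣m*n n) ⟩
    (- 1#) ^ᴿ u · gcdClassSum (- ω) (2 * n) u 1       ≈⟨ *-congˡ (gcdClassSum-double u 2∤n [-ω]ⁿ≈1) ⟩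
    (- 1#) ^ᴿ u · gcdClassSum (- ω) n u 1             ≈⟨ *-congˡ (ramanujan≈gcdClassSum (- ω) n u [-ω]ⁿ≈1) ⟨
    (- 1#) ^ᴿ u · ramanujan R (- ω) n u               ∎
    where
    [-ω]ⁿ≈1 : (- ω) ^ᴿ n ≈ 1#
    [-ω]ⁿ≈1 = neg-pow-odd≈1 2∤n ωⁿ≈-1

  sum0below-double-period : ∀ ξ n y → ξ ^ᴿ n ≈ 1# →
    ∑[ u < 2 * n ] (ramanujan R ξ n u · y ^ᴿ u) ≈ (1# + y ^ᴿ n) · ramanujanPoly R ξ n y
  sum0below-double-period ξ n y ξⁿ≈1 = begin
    Σ< (2 * n) g                            ≡⟨ ≡.cong (λ m → Σ< (n ℕ.+ m) g) (ℕₚ.+-identityʳ n) ⟩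
    Σ< (n ℕ.+ n) g                          ≈⟨ sum0below-+ n n g ⟩
    P + ∑[ s < n ] g (n ℕ.+ s)              ≈⟨ +-congˡ (sum0below-cong n (λ s _ → shifted s)) ⟩
    P + ∑[ s < n ] (y ^ᴿ n · g s)           ≈⟨ +-congˡ (*-distribˡ-sum0below n _ g) ⟨
    P + y ^ᴿ n · P                          ≈⟨ +-congʳ (*-identityˡ P) ⟨
    1# · P + y ^ᴿ n · P                     ≈⟨ distribʳ P 1# (y ^ᴿ n) ⟨
    (1# + y ^ᴿ n) · P                       ∎
    where
    g : ℕ → Carrier
    g u = ramanujan R ξ n u · y ^ᴿ u

    P : Carrier
    P = ramanujanPoly R ξ n y

    shifted : ∀ s → g (n ℕ.+ s) ≈ y ^ᴿ n · g s
    shifted s = trans (*-cong (ramanujan-periodic ξ n s ξⁿ≈1) (pow-homo-* y n s)) (x*yz≈y*xz _ _ _)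

  gcdClassSum-blocks : ∀ {ω} M B m → (∀ {x} → Coprime x B → Coprime x M) →
    gcdClassSum ω (M * B) m 1 ≈ Σ< M ((ω ^ᴿ (B * m)) ^ᴿ_) · gcdClassSum ω B m 1
  gcdClassSum-blocks {ω} M B m B⊥⇒M⊥ = begin
    Σ< (M * B) f                                  ≈⟨ sum0below-blocks M B f ⟩
    ∑[ t < M ] ∑[ r < B ] f (t * B ℕ.+ r)         ≈⟨ sum0below-cong M (λ t _ → block t) ⟩
    ∑[ t < M ] (a ^ᴿ t · S)                       ≈⟨ *-distribʳ-sum0below M S (a ^ᴿ_) ⟨
    Σ< M (a ^ᴿ_) · S                              ∎
    where
    a : Carrier
    a = ω ^ᴿ (B * m)

    S : Carrier
    S = gcdClassSum ω B m 1

    f : ℕ → Carrier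
    f j = select (gcd j (M * B) ≟ 1) (ω ^ᴿ (j * m))

    exponent : ∀ t B r m → (t * B ℕ.+ r) * m ≡ (B * m) * t ℕ.+ r * m
    exponent = solve-∀

    value : ∀ t r → ω ^ᴿ ((t * B ℕ.+ r) * m) ≈ a ^ᴿ t · ω ^ᴿ (r * m)
    value t r = begin
      ω ^ᴿ ((t * B ℕ.+ r) * m)          ≡⟨ ≡.cong (ω ^ᴿ_) (exponent t B r m) ⟩
      ω ^ᴿ ((B * m) * t ℕ.+ r * m)      ≈⟨ pow-homo-* ω (B * m * t) (r * m) ⟩
      ω ^ᴿ ((B * m) * t) · ω ^ᴿ (r * m) ≈⟨ *-congʳ (pow-assocʳ ω (B * m) t) ⟨
      a ^ᴿ t · ω ^ᴿ (r * m)             ∎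

    block : ∀ t → ∑[ r < B ] f (t * B ℕ.+ r) ≈ a ^ᴿ t · S
    block t = trans (sum0below-cong B λ r _ → trans (select-coprime-cong (coprime-+-*⇔ B⊥⇒M⊥ t r) (value t r))
                                                     (sym (*-distribˡ-select (gcd r B ≟ 1) _ _)))
                    (sym (*-distribˡ-sum0below B _ _))

  -- Integral domains

  module _ (domain : IsDomain R) where

    private
      noZeroDivisors : ∀ a b → a · b ≈ 0# → a ≈ 0# ⊎ b ≈ 0#
      noZeroDivisors = proj₂ domain

    square≈1⇒±1 : ∀ {p} → p · p ≈ 1# → p ≈ 1# ⊎ p ≈ - 1#
    square≈1⇒±1 {p} p²≈1 with noZeroDivisors (p - 1#) (p + 1#) factored
      where
      factored : (p - 1#) · (p + 1#) ≈ 0#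
      factored = begin
        (p - 1#) · (p + 1#)             ≈⟨ distribˡ (p - 1#) p 1# ⟩
        (p - 1#) · p + (p - 1#) · 1#    ≈⟨ +-cong ([y-z]x≈yx-zx p p 1#) (*-identityʳ _) ⟩
        (p · p - 1# · p) + (p - 1#)     ≈⟨ +-congʳ (+-cong p²≈1 (-‿cong (*-identityˡ p))) ⟩
        (1# - p) + (p - 1#)             ≈⟨ +-congʳ (⁻¹-anti-homo‿- p 1#) ⟨
        - (p - 1#) + (p - 1#)           ≈⟨ -‿inverseˡ _ ⟩
        0#                              ∎
    ... | inj₁ p-1≈0 = inj₁ (x∙y⁻¹≈ε⇒x≈y p 1# p-1≈0)
    ... | inj₂ p+1≈0 = inj₂ (+-inverseˡ-unique p 1# p+1≈0)

    pow-half≈-1 : ∀ {ω n} .{{_ : NonZero n}} → IsPrimitiveRoot R ω (2 * n) → ω ^ᴿ n ≈ - 1#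
    pow-half≈-1 {ω} {n@(suc _)} (ω²ⁿ≈1 , minimal) with square≈1⇒±1 ωⁿωⁿ≈1
      where
      ωⁿωⁿ≈1 : ω ^ᴿ n · ω ^ᴿ n ≈ 1#
      ωⁿωⁿ≈1 = begin
        ω ^ᴿ n · ω ^ᴿ n          ≈⟨ pow-homo-* ω n n ⟨
        ω ^ᴿ (n ℕ.+ n)           ≡⟨ ≡.cong (λ m → ω ^ᴿ (n ℕ.+ m)) (ℕₚ.+-identityʳ n) ⟨
        ω ^ᴿ (2 * n)             ≈⟨ ω²ⁿ≈1 ⟩
        1#                       ∎
    ... | inj₁ ωⁿ≈1  = contradiction ωⁿ≈1 (minimal n (>-nonZero⁻¹ n) (m<m+n n z<s))
    ... | inj₂ ωⁿ≈-1 = ωⁿ≈-1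

    sum0below-pow≈0 : ∀ {a} m → a ^ᴿ m ≈ 1# → ¬ a ≈ 1# → Σ< m (a ^ᴿ_) ≈ 0#
    sum0below-pow≈0 {a} m aᵐ≈1 a≉1
      with noZeroDivisors (a - 1#) _ (trans (geometric-sum a m) (x≈y⇒x∙y⁻¹≈ε aᵐ≈1))
    ... | inj₁ a-1≈0 = contradiction (x∙y⁻¹≈ε⇒x≈y a 1# a-1≈0) a≉1
    ... | inj₂ sum≈0 = sum≈0

    sum0below-pow1 : ∀ {a} m → a ≈ 1# → Σ< m (a ^ᴿ_) ≈ m ×ᴿ 1#
    sum0below-pow1 m a≈1 = trans (sum0below-cong m (λ i _ → trans (pow-congˡ i a≈1) (pow-1# i))) (sum0below-const m 1#)

    -- Both sides equal n or 0 according to whether n ∣ k.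
    powerSum-root-independent : ∀ {η η′ n} k .{{_ : NonZero n}} → IsPrimitiveRoot R η n → IsPrimitiveRoot R η′ n →
                                ∑[ j < n ] η ^ᴿ (j * k) ≈ ∑[ j < n ] η′ ^ᴿ (j * k)
    powerSum-root-independent {n = n} k prim prim′ with n ∣? k
    ... | yes n∣k = trans (value₁ prim) (sym (value₁ prim′))
      where
      value₁ : ∀ {ξ} → IsPrimitiveRoot R ξ n → ∑[ j < n ] ξ ^ᴿ (j * k) ≈ n ×ᴿ 1#
      value₁ {ξ} (ξⁿ≈1 , _) = trans (powerSum≈geometric ξ n k) (sum0below-pow1 n (pow-∣≈1 ξⁿ≈1 n∣k))
    ... | no n∤k = trans (value₀ prim) (sym (value₀ prim′))
      where
      value₀ : ∀ {ξ} → IsPrimitiveRoot R ξ n → ∑[ j < n ] ξ ^ᴿ (j * k) ≈ 0#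
      value₀ {ξ} ξ-prim@(ξⁿ≈1 , _) = trans (powerSum≈geometric ξ n k)
        (sum0below-pow≈0 n (trans (pow-assocʳ ξ k n) (pow-∣≈1 ξⁿ≈1 (n∣m*n k))) (n∤k ∘ primitive⇒∣ ξ-prim))

    RootIndependent : ℕ → Set (c ⊔ ℓ)
    RootIndependent n = ∀ k {η η′} → IsPrimitiveRoot R η n → IsPrimitiveRoot R η′ n →
                        gcdClassSum η n k 1 ≈ gcdClassSum η′ n k 1

    -- Split ∑_{j<n} η^{jk} by d = gcd(j,n): class 1 is c_n(k), and a class d ≥ 2 with d ∣ n
    -- is c_{n/d}(k) for the root η^d, covered by the induction hypothesis.
    gcdClassSum-root-independent : ∀ n → RootIndependent n
    gcdClassSum-root-independent = <-rec RootIndependent step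
      where
      step : ∀ n → (∀ {m} → m < n → RootIndependent m) → RootIndependent n
      step zero       _  k _ _ = refl
      step n@(suc n′) ih k {η} {η′} prim prim′ = +-cancelʳ (T η) _ _ (+-cancelˡ (C η 0) _ _ (begin
        C η 0 + (C η 1 + T η)           ≈⟨ peel η ⟨
        ∑[ d < suc n ] C η d            ≈⟨ total ⟩
        ∑[ d < suc n ] C η′ d           ≈⟨ peel η′ ⟩
        C η′ 0 + (C η′ 1 + T η′)        ≈⟨ +-cong (sym class₀) (+-congˡ (sym tail)) ⟩
        C η 0 + (C η′ 1 + T η)          ∎))
        where
        C : Carrier → ℕ → Carrier
        C ξ d = gcdClassSum ξ n k d

        T : Carrier → Carrier
        T ξ = ∑[ d < n′ ] C ξ (2 ℕ.+ d)

        peel : ∀ ξ → ∑[ d < suc n ] C ξ d ≈ C ξ 0 + (C ξ 1 + T ξ)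
        peel ξ = trans (sum0below-suc n _) (+-congˡ (sum0below-suc n′ _))

        total : ∑[ d < suc n ] C η d ≈ ∑[ d < suc n ] C η′ d
        total = trans (sym (sum0below-partition-gcd n _))
                      (trans (powerSum-root-independent k prim prim′) (sum0below-partition-gcd n _))

        class₀ : C η 0 ≈ C η′ 0
        class₀ = trans (gcdClassSum-∤ k 0∤n) (sym (gcdClassSum-∤ k 0∤n))
          where
          0∤n : ¬ 0 ∣ n
          0∤n 0∣n with 0∣⇒≡0 0∣n
          ... | ()

        class₂₊ : ∀ d → C η (2 ℕ.+ d) ≈ C η′ (2 ℕ.+ d)
        class₂₊ d with (2 ℕ.+ d) ∣? n
        ... | no  d∤n = trans (gcdClassSum-∤ k d∤n) (sym (gcdClassSum-∤ k d∤n))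
        ... | yes d∣n = begin
          C η (2 ℕ.+ d)                                           ≈⟨ gcdClassSum-divisor k d∣n ⟩
          gcdClassSum (η ^ᴿ (2 ℕ.+ d)) (quotient d∣n) k 1         ≈⟨ ih (quotient-< d∣n) k (IsPrimitiveRoot-pow d∣n prim)
                                                                                            (IsPrimitiveRoot-pow d∣n prim′) ⟩
          gcdClassSum (η′ ^ᴿ (2 ℕ.+ d)) (quotient d∣n) k 1        ≈⟨ gcdClassSum-divisor k d∣n ⟨
          C η′ (2 ℕ.+ d)                                          ∎

        tail : T η ≈ T η′
        tail = sum0below-cong n′ λ d _ → class₂₊ d

    ramanujan-root-independent : ∀ {n η η′} k → IsPrimitiveRoot R η n → IsPrimitiveRoot R η′ n →
                                 ramanujan R η n k ≈ ramanujan R η′ n k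
    ramanujan-root-independent {n} {η} {η′} k prim prim′ = begin
      ramanujan R η n k      ≈⟨ ramanujan≈gcdClassSum η n k (proj₁ prim) ⟩
      gcdClassSum η n k 1    ≈⟨ gcdClassSum-root-independent n k prim prim′ ⟩
      gcdClassSum η′ n k 1   ≈⟨ ramanujan≈gcdClassSum η′ n k (proj₁ prim′) ⟨
      ramanujan R η′ n k     ∎

    ramanujanPoly-double : ∀ {n ζ ω} → ¬ 2 ∣ n → IsPrimitiveRoot R ζ n → IsPrimitiveRoot R ω (2 * n) → ∀ x →
                           ramanujanPoly R ω (2 * n) x ≈ (1# - x ^ᴿ n) · ramanujanPoly R ζ n (- x)
    ramanujanPoly-double {n} {ζ} {ω} 2∤n ζ-prim ω-prim x = begin
      ∑[ u < 2 * n ] (ramanujan R ω (2 * n) u · x ^ᴿ u)    ≈⟨ sum0below-cong (2 * n) (λ u _ → coefficient u) ⟩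
      ∑[ u < 2 * n ] (ramanujan R (- ω) n u · (- x) ^ᴿ u)  ≈⟨ sum0below-double-period (- ω) n (- x) (proj₁ -ω-prim) ⟩
      (1# + (- x) ^ᴿ n) · ramanujanPoly R (- ω) n (- x)    ≈⟨ *-cong (+-congˡ (pow-neg-odd x 2∤n)) change-root ⟩
      (1# - x ^ᴿ n) · ramanujanPoly R ζ n (- x)            ∎
      where
      ωⁿ≈-1 : ω ^ᴿ n ≈ - 1#
      ωⁿ≈-1 = pow-half≈-1 {{odd⇒nonZero 2∤n}} ω-prim

      -ω-prim : IsPrimitiveRoot R (- ω) n
      -ω-prim = neg-IsPrimitiveRoot 2∤n ω-prim ωⁿ≈-1

      change-root : ramanujanPoly R (- ω) n (- x) ≈ ramanujanPoly R ζ n (- x)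
      change-root = sum0below-cong n λ u _ → *-congʳ (ramanujan-root-independent u -ω-prim ζ-prim)

      coefficient : ∀ u → ramanujan R ω (2 * n) u · x ^ᴿ u ≈ ramanujan R (- ω) n u · (- x) ^ᴿ u
      coefficient u = begin
        ramanujan R ω (2 * n) u · x ^ᴿ u                        ≈⟨ *-congʳ (ramanujan-double u 2∤n (proj₁ ω-prim) ωⁿ≈-1) ⟩
        ((- 1#) ^ᴿ u · ramanujan R (- ω) n u) · x ^ᴿ u          ≈⟨ xy*z≈y*xz _ _ _ ⟩
        ramanujan R (- ω) n u · ((- 1#) ^ᴿ u · x ^ᴿ u)          ≈⟨ *-congˡ (pow-neg x u) ⟨
        ramanujan R (- ω) n u · (- x) ^ᴿ u                      ∎

    -- The hypothesis says that every prime factor of M divides B.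
    ramanujanPoly-inflate : ∀ {ω} M B .{{_ : NonZero M}} .{{_ : NonZero B}} → (∀ {x} → Coprime x B → Coprime x M) →
      IsPrimitiveRoot R ω (M * B) → ∀ x → ramanujanPoly R ω (M * B) x ≈ M ×ᴿ 1# · ramanujanPoly R (ω ^ᴿ M) B (x ^ᴿ M)
    ramanujanPoly-inflate {ω} M B B⊥⇒M⊥ ω-prim@(ωᴹᴮ≈1 , _) x = begin
      Σ< (M * B) h                                                ≡⟨ ≡.cong (λ N → Σ< N h) (ℕₚ.*-comm M B) ⟩
      Σ< (B * M) h                                                ≈⟨ sum0below-multiples B M h h-off ⟩
      ∑[ u < B ] h (u * M)                                        ≈⟨ sum0below-cong B (λ u _ → h-multiple u) ⟩
      ∑[ u < B ] (M ×ᴿ 1# · (ramanujan R (ω ^ᴿ M) B u · (x ^ᴿ M) ^ᴿ u))  ≈⟨ *-distribˡ-sum0below B _ _ ⟨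
      M ×ᴿ 1# · ramanujanPoly R (ω ^ᴿ M) B (x ^ᴿ M)               ∎
      where
      instance
        MB≢0 : NonZero (M * B)
        MB≢0 = m*n≢0 M B

      B*m*M≡m*[M*B] : ∀ B m M → B * m * M ≡ m * (M * B)
      B*m*M≡m*[M*B] = solve-∀

      B*[u*M]≡u*[M*B] : ∀ B u M → B * (u * M) ≡ u * (M * B)
      B*[u*M]≡u*[M*B] = solve-∀

      h : ℕ → Carrier
      h m = ramanujan R ω (M * B) m · x ^ᴿ m

      a : ℕ → Carrier
      a m = ω ^ᴿ (B * m)

      coefficient : ∀ m → ramanujan R ω (M * B) m ≈ Σ< M (a m ^ᴿ_) · gcdClassSum ω B m 1
      coefficient m = trans (ramanujan≈gcdClassSum ω (M * B) m ωᴹᴮ≈1) (gcdClassSum-blocks M B m B⊥⇒M⊥)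

      h-off : ∀ m → ¬ M ∣ m → h m ≈ 0#
      h-off m M∤m = trans (*-congʳ (trans (coefficient m) (trans (*-congʳ geometric≈0) (zeroˡ _)))) (zeroˡ _)
        where
        aᴹ≈1 : a m ^ᴿ M ≈ 1#
        aᴹ≈1 = trans (pow-assocʳ ω (B * m) M) (pow-∣≈1 ωᴹᴮ≈1 (divides m (B*m*M≡m*[M*B] B m M)))

        a≉1 : ¬ a m ≈ 1#
        a≉1 a≈1 = M∤m (*-cancelʳ-∣ B (≡.subst (M * B ∣_) (ℕₚ.*-comm B m) (primitive⇒∣ ω-prim a≈1)))

        geometric≈0 : Σ< M (a m ^ᴿ_) ≈ 0#
        geometric≈0 = sum0below-pow≈0 M aᴹ≈1 a≉1

      h-multiple : ∀ u → h (u * M) ≈ M ×ᴿ 1# · (ramanujan R (ω ^ᴿ M) B u · (x ^ᴿ M) ^ᴿ u)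
      h-multiple u = begin
        ramanujan R ω (M * B) (u * M) · x ^ᴿ (u * M)                      ≈⟨ *-cong (coefficient (u * M)) xᵘᴹ≈ ⟩
        (Σ< M (a (u * M) ^ᴿ_) · gcdClassSum ω B (u * M) 1) · (x ^ᴿ M) ^ᴿ u  ≈⟨ *-congʳ (*-cong geometric≈M class≈) ⟩
        (M ×ᴿ 1# · ramanujan R (ω ^ᴿ M) B u) · (x ^ᴿ M) ^ᴿ u              ≈⟨ *-assoc _ _ _ ⟩
        M ×ᴿ 1# · (ramanujan R (ω ^ᴿ M) B u · (x ^ᴿ M) ^ᴿ u)              ∎
        where
        geometric≈M : Σ< M (a (u * M) ^ᴿ_) ≈ M ×ᴿ 1#
        geometric≈M = sum0below-pow1 M (pow-∣≈1 ωᴹᴮ≈1 (divides u (B*[u*M]≡u*[M*B] B u M)))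

        class≈ : gcdClassSum ω B (u * M) 1 ≈ ramanujan R (ω ^ᴿ M) B u
        class≈ = trans (gcdClassSum-pow B u M 1)
                       (sym (ramanujan≈gcdClassSum (ω ^ᴿ M) B u (trans (pow-assocʳ ω M B) ωᴹᴮ≈1)))

        xᵘᴹ≈ : x ^ᴿ (u * M) ≈ (x ^ᴿ M) ^ᴿ u
        xᵘᴹ≈ = trans (reflexive (≡.cong (x ^ᴿ_) (ℕₚ.*-comm u M))) (sym (pow-assocʳ x M u))

    ramanujanPoly-2^[1+k]*n : ∀ {n ζ ω} k → ¬ 2 ∣ n → IsPrimitiveRoot R ζ n → IsPrimitiveRoot R ω (2 ^ suc k * n) → ∀ x →
      ramanujanPoly R ω (2 ^ suc k * n) x
        ≈ (1# + 1#) ^ᴿ k · ((1# - x ^ᴿ (2 ^ k * n)) · ramanujanPoly R ζ n (- x ^ᴿ (2 ^ k)))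
    ramanujanPoly-2^[1+k]*n {n} {ζ} {ω} k 2∤n ζ-prim ω-prim x = begin
      ramanujanPoly R ω (2 ^ suc k * n) x                       ≡⟨ ≡.cong (λ N → ramanujanPoly R ω N x) N≡MB ⟩
      ramanujanPoly R ω (M * (2 * n)) x                         ≈⟨ ramanujanPoly-inflate M (2 * n) 2n⊥⇒M⊥ ω-prim′ x ⟩
      M ×ᴿ 1# · ramanujanPoly R (ω ^ᴿ M) (2 * n) (x ^ᴿ M)       ≈⟨ *-cong (2^k×1≈[1+1]^k k)
                                                                      (ramanujanPoly-double 2∤n ζ-prim ωᴹ-prim (x ^ᴿ M)) ⟩
      (1# + 1#) ^ᴿ k · ((1# - (x ^ᴿ M) ^ᴿ n) · ramanujanPoly R ζ n (- x ^ᴿ M))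
                                                                ≈⟨ *-congˡ (*-congʳ (+-congˡ (-‿cong (pow-assocʳ x M n)))) ⟩
      (1# + 1#) ^ᴿ k · ((1# - x ^ᴿ (M * n)) · ramanujanPoly R ζ n (- x ^ᴿ M)) ∎
      where
      M : ℕ
      M = 2 ^ k

      instance
        M≢0 : NonZero M
        M≢0 = m^n≢0 2 k

        2n≢0 : NonZero (2 * n)
        2n≢0 = m*n≢0 2 n {{_}} {{odd⇒nonZero 2∤n}}

      N≡MB : 2 ^ suc k * n ≡ M * (2 * n)
      N≡MB = 2*M*n≡M*[2*n] M n
        where
        2*M*n≡M*[2*n] : ∀ M n → 2 * M * n ≡ M * (2 * n)
        2*M*n≡M*[2*n] = solve-∀

      2n⊥⇒M⊥ : ∀ {x} → Coprime x (2 * n) → Coprime x M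
      2n⊥⇒M⊥ c = coprime-^ (coprime-∣ʳ c (m∣m*n n)) k

      ω-prim′ : IsPrimitiveRoot R ω (M * (2 * n))
      ω-prim′ = ≡.subst (IsPrimitiveRoot R ω) N≡MB ω-prim

      ωᴹ-prim : IsPrimitiveRoot R (ω ^ᴿ M) (2 * n)
      ωᴹ-prim = IsPrimitiveRoot-pow (m∣m*n (2 * n)) ω-prim′

theorem6 : ∀ {c ℓ : Level} (R : CommutativeRing c ℓ) → IsDomain R →
    let open CommutativeRing R renaming (_*_ to _·_) in
    (∀ (n : ℕ) → 1 ≤ n → ¬ (2 ∣ n) →
      ∀ (ζ ω : Carrier) → IsPrimitiveRoot R ζ n → IsPrimitiveRoot R ω (2 * n) →
      ∀ (x : Carrier) →
        ramanujanPoly R ω (2 * n) x ≈ (1# - pow R x n) · ramanujanPoly R ζ n (- x))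
    ×
    (∀ (n : ℕ) → 1 ≤ n → ¬ (2 ∣ n) → ∀ (k : ℕ) → 1 ≤ k →
      ∀ (ζ ω : Carrier) → IsPrimitiveRoot R ζ n → IsPrimitiveRoot R ω (2 ^ k * n) →
      ∀ (x : Carrier) →
        ramanujanPoly R ω (2 ^ k * n) x
          ≈ pow R (1# + 1#) (k ∸ 1)
            · ((1# - pow R x (2 ^ (k ∸ 1) * n))
               · ramanujanPoly R ζ n (- pow R x (2 ^ (k ∸ 1)))))
theorem6 R domain =
  (λ n _ 2∤n ζ ω → ramanujanPoly-double R domain 2∤n) ,
  λ { n _ 2∤n zero () ; n _ 2∤n (suc k) _ ζ ω → ramanujanPoly-2^[1+k]*n R domain k 2∤n }
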